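{- Let $X,Y$ be NUTS and $t\in\mathbf{NUTS}(X,Y)$. Then $t$ is an isomorphism in $\mathbf{NUTS}$ if and only if $t$ is the graph of a bijection $|X|\to|Y|$ such that for all $u\subseteq|X|$, $u\in\mathcal T(X)\iff t(u)\in\mathcal T(Y)$.
   Context: For $\mathcal T\subseteq\mathcal P(E)$, $\mathcal T^\perp=\{u'\subseteq E\mid\forall u\in\mathcal T,\ u\cap u'\neq\emptyset\}$. A NUTS is $X=(|X|,\mathcal T(X))$ with $\mathcal T(X)\subseteq\mathcal P(|X|)$ and $\mathcal T(X)=\mathcal T(X)^{\perp\perp}$; $X^\perp=(|X|,\mathcal T(X)^\perp)$, $X\otimes Y=(|X|\times|Y|,\{u\times v\mid u\in\mathcal T(X),v\in\mathcal T(Y)\}^{\perp\perp})$, $X\multimap Y=(X\otimes Y^\perp)^\perp$. The category $\mathbf{NUTS}$ has NUTS as objects, $\mathbf{NUTS}(X,Y)=\mathcal T(X\multimap Y)$ (relations $t\subseteq|X|\times|Y|$), relational composition and diagonal identities. For $t\subseteq E\times F$ and $u\subseteq E$, $t(u)=\{b\mid\exists a\in u,(a,b)\in t\}$. -}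

module Defs where

open import Level using (Level; _⊔_) renaming (suc to lsuc; zero to lzero)
open import Data.Product using (Σ; ∃; ∃-syntax; _×_; _,_; proj₁; proj₂)
open import Relation.Binary.PropositionalEquality using (_≡_)
open import Function.Definitions using (Bijective)

Subset : Set → Set₁
Subset E = E → Set

Family : Set → Set₂
Family E = Subset E → Set₁

_≐_ : {E : Set} → Subset E → Subset E → Set
u ≐ v = ∀ a → (u a → v a) × (v a → u a)

_≐F_ : {E : Set} → Family E → Family E → Set₁
T ≐F T' = ∀ u → (T u → T' u) × (T' u → T u)

_⊥ : {E : Set} → Family E → Family E
(T ⊥) u' = ∀ u → T u → ∃[ a ] (u a × u' a)

record NUTS : Set₂ where
  field
    web : Set
    T   : Family web
    biorth : T ≐F ((T ⊥) ⊥)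
open NUTS public

Rect : {E F : Set} → Family E → Family F → Family (E × F)
Rect T S w = ∃[ u ] ∃[ v ] (T u × S v × (w ≐ (λ p → u (proj₁ p) × v (proj₂ p))))

Tensor : {E F : Set} → Family E → Family F → Family (E × F)
Tensor T S = (Rect T S ⊥) ⊥

TLin : (X Y : NUTS) → Family (web X × web Y)
TLin X Y = Tensor (T X) (T Y ⊥) ⊥

Rel : Set → Set → Set₁
Rel E F = Subset (E × F)

Hom : (X Y : NUTS) → Rel (web X) (web Y) → Set₁
Hom X Y t = TLin X Y t

_∘ʳ_ : {A B C : Set} → Rel B C → Rel A B → Rel A C
(s ∘ʳ t) (a , c) = ∃[ b ] (t (a , b) × s (b , c))

idʳ : (A : Set) → Rel A A
idʳ A (a , a') = a ≡ a'

IsIso : (X Y : NUTS) → Rel (web X) (web Y) → Set₁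
IsIso X Y t = Σ (Rel (web Y) (web X)) λ s →
  Hom Y X s × ((s ∘ʳ t) ≐ idʳ (web X)) × ((t ∘ʳ s) ≐ idʳ (web Y))

image : {E F : Set} → Rel E F → Subset E → Subset F
image t u b = ∃[ a ] (u a × t (a , b))

IsBijGraph : {E F : Set} → Rel E F → (E → F) → Set
IsBijGraph t f = Bijective _≡_ _≡_ f × (∀ a b → (t (a , b) → f a ≡ b) × (f a ≡ b → t (a , b)))

module Submission where

open import Defs
open import Data.Product using (Σ; _×_; _,_; proj₁; proj₂)
open import Function.Definitions using (Surjective)
open import Function.Consequences.Propositional using (strictlySurjective⇒surjective)
open import Relation.Binary.PropositionalEquality using (_≡_; refl; sym; trans; subst)

-- A relation t is in 𝒯(X ⊸ Y) exactly when its direct image maps 𝒯(X) into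
-- 𝒯(Y). An isomorphism and its inverse therefore transport 𝒯 both ways, and
-- conversely a bijective graph that transports 𝒯 both ways has its converse
-- as inverse, which is a morphism because it maps 𝒯(Y) onto preimages whose
-- images are again in 𝒯(Y).

≐-refl : {E : Set} {u : Subset E} → u ≐ u
≐-refl a = (λ x → x) , (λ x → x)

≐-sym : {E : Set} {u v : Subset E} → u ≐ v → v ≐ u
≐-sym e a = proj₂ (e a) , proj₁ (e a)

⊥-resp-≐ : {E : Set} (S : Family E) {v w : Subset E} → v ≐ w → (S ⊥) v → (S ⊥) w
⊥-resp-≐ S e Sv u Su with Sv u Su
... | a , ua , va = a , ua , proj₁ (e a) va

⊆-⊥⊥ : {E : Set} (S : Family E) {w : Subset E} → S w → ((S ⊥) ⊥) w
⊆-⊥⊥ S Sw u' Su' with Su' _ Sw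
... | a , wa , u'a = a , u'a , wa

T-resp-≐ : (X : NUTS) {v w : Subset (web X)} → v ≐ w → T X v → T X w
T-resp-≐ X e Tv = proj₂ (biorth X _) (⊥-resp-≐ (T X ⊥) e (proj₁ (biorth X _) Tv))

converse : {E F : Set} → Rel E F → Rel F E
converse t (b , a) = t (a , b)

MapsT : (X Y : NUTS) → Rel (web X) (web Y) → Set₁
MapsT X Y t = ∀ u → T X u → T Y (image t u)

Hom⇒MapsT : (X Y : NUTS) {t : Rel (web X) (web Y)} → Hom X Y t → MapsT X Y t
Hom⇒MapsT X Y ht u Tu = proj₂ (biorth Y _) λ v' Tv' →
  let ((a , b) , (ua , v'b) , tab) = ht _ (⊆-⊥⊥ (Rect (T X) (T Y ⊥)) (u , v' , Tu , Tv' , ≐-refl))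
  in b , v'b , (a , ua , tab)

-- 𝒯(X ⊸ Y) = Rect⊥⊥⊥ = Rect⊥, so meeting every rectangle suffices.
MapsT⇒Hom : (X Y : NUTS) {t : Rel (web X) (web Y)} → MapsT X Y t → Hom X Y t
MapsT⇒Hom X Y {t} mt = ⊆-⊥⊥ (Rect (T X) (T Y ⊥) ⊥) meets-rectangles
  where
  meets-rectangles : (Rect (T X) (T Y ⊥) ⊥) t
  meets-rectangles w (u , v' , Tu , Tv' , e) with Tv' _ (mt u Tu)
  ... | b , (a , ua , tab) , v'b = (a , b) , proj₂ (e (a , b)) (ua , v'b) , tab

image-∘ʳ-idʳ : {E F : Set} {t : Rel E F} {s : Rel F E} →
  (s ∘ʳ t) ≐ idʳ E → (u : Subset E) → image s (image t u) ≐ u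
image-∘ʳ-idʳ st u a =
    (λ { (b , (a' , ua' , ta'b) , sba) → subst u (proj₁ (st (a' , a)) (b , ta'b , sba)) ua' })
  , (λ ua → let (b , tab , sba) = proj₂ (st (a , a)) refl in b , (a , ua , tab) , sba)

inverse⇒bijGraph : {E F : Set} {t : Rel E F} {s : Rel F E} →
  (s ∘ʳ t) ≐ idʳ E → (t ∘ʳ s) ≐ idʳ F → Σ (E → F) (IsBijGraph t)
inverse⇒bijGraph {E} {F} {t} {s} st ts = f , (injective , surjective) , graph
  where
  f : E → F
  f a = proj₁ (proj₂ (st (a , a)) refl)
  tf : ∀ a → t (a , f a)
  tf a = proj₁ (proj₂ (proj₂ (st (a , a)) refl))
  sf : ∀ a → s (f a , a)
  sf a = proj₂ (proj₂ (proj₂ (st (a , a)) refl))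
  graph : ∀ a b → (t (a , b) → f a ≡ b) × (f a ≡ b → t (a , b))
  graph a b = (λ tab → proj₁ (ts (f a , b)) (a , sf a , tab)) , λ { refl → tf a }
  injective : ∀ {x y} → f x ≡ f y → x ≡ y
  injective {x} {y} e = sym (proj₁ (st (y , x)) (f y , tf y , subst (λ b → s (b , x)) e (sf x)))
  surjective : Surjective _≡_ _≡_ f
  surjective = strictlySurjective⇒surjective λ b →
    let (a , _ , tab) = proj₂ (ts (b , b)) refl in a , proj₁ (graph a b) tab

bijGraph⇒converse-inverse : {E F : Set} {t : Rel E F} {f : E → F} → IsBijGraph t f →
  ((converse t ∘ʳ t) ≐ idʳ E) × ((t ∘ʳ converse t) ≐ idʳ F)
bijGraph⇒converse-inverse {t = t} {f} ((injective , surjective) , graph) = left , right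
  where
  left : (converse t ∘ʳ t) ≐ idʳ _
  left (a , a') =
      (λ { (b , tab , ta'b) → injective (trans (proj₁ (graph a b) tab) (sym (proj₁ (graph a' b) ta'b))) })
    , (λ { refl → f a , proj₂ (graph a (f a)) refl , proj₂ (graph a (f a)) refl })
  right : (t ∘ʳ converse t) ≐ idʳ _
  right (b , b') =
      (λ { (a , tab , tab') → trans (sym (proj₁ (graph a b) tab)) (proj₁ (graph a b') tab') })
    , (λ { refl → let (a , fa≡b) = surjective b ; tab = proj₂ (graph a b) (fa≡b refl) in a , tab , tab })

TransportsT : (X Y : NUTS) → Rel (web X) (web Y) → Set₁
TransportsT X Y t = ∀ u → (T X u → T Y (image t u)) × (T Y (image t u) → T X u)

iso⇒bijGraph-transportsT : (X Y : NUTS) {t : Rel (web X) (web Y)} → Hom X Y t →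
  IsIso X Y t → Σ (web X → web Y) λ f → IsBijGraph t f × TransportsT X Y t
iso⇒bijGraph-transportsT X Y ht (s , hs , st , ts) =
  let (f , bij) = inverse⇒bijGraph st ts
  in f , bij , λ u → Hom⇒MapsT X Y ht u
                   , λ Ttu → T-resp-≐ X (image-∘ʳ-idʳ st u) (Hom⇒MapsT Y X hs _ Ttu)

bijGraph-transportsT⇒iso : (X Y : NUTS) {t : Rel (web X) (web Y)} →
  Σ (web X → web Y) (λ f → IsBijGraph t f × TransportsT X Y t) → IsIso X Y t
bijGraph-transportsT⇒iso X Y {t} (_ , bij , transports) = converse t , MapsT⇒Hom Y X converse-mapsT , st , ts
  where
  st : (converse t ∘ʳ t) ≐ idʳ (web X)
  st = proj₁ (bijGraph⇒converse-inverse bij)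
  ts : (t ∘ʳ converse t) ≐ idʳ (web Y)
  ts = proj₂ (bijGraph⇒converse-inverse bij)
  converse-mapsT : MapsT Y X (converse t)
  converse-mapsT v Tv = proj₂ (transports _) (T-resp-≐ Y (≐-sym (image-∘ʳ-idʳ ts v)) Tv)

lemma4p3 : (X Y : NUTS) (t : Rel (web X) (web Y)) → Hom X Y t →
    (IsIso X Y t → Σ (web X → web Y) λ f → IsBijGraph t f × (∀ u → (T X u → T Y (image t u)) × (T Y (image t u) → T X u)))
    × (Σ (web X → web Y) (λ f → IsBijGraph t f × (∀ u → (T X u → T Y (image t u)) × (T Y (image t u) → T X u))) → IsIso X Y t)
lemma4p3 X Y t ht = iso⇒bijGraph-transportsT X Y ht , bijGraph-transportsT⇒iso X Y
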